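{- Let $F$ be a global function field of characteristic $p$, $\mathfrak{p}$ a prime of $F$, and $G$ a finite abelian $p$-group of exponent $p^e$. The formal series $$\Phi_{G,\mathfrak{p}}(s)=\sum_{m\ge0}b_G(\mathfrak{p}^m)\mathcal{N}\mathfrak{p}^{ -ms}$$ has a meromorphic continuation to all $s\in\mathbb{C}$, given by $\Phi_{G,\mathfrak{p}}(s)=\Lambda_{G,\mathfrak{p}}(s)\Psi_{G,\mathfrak{p}}(s)$, where $$\Lambda_{G,\mathfrak{p}}(s)=\prod_{l=2}^{p^e}\zeta_{F,\mathfrak{p}}\Big(ls-\sum_{i=1}^e r_i(G)w_i(l)\Big),\qquad \Psi_{G,\mathfrak{p}}(s)=\Big(1+\sum_{l=1}^{p^e-1}u_G(\mathfrak{p}^l)\mathcal{N}\mathfrak{p}^{ -ls}\Big)\prod_{l=1}^{p^e-1}\big(1-u_G(\mathfrak{p}^l)\mathcal{N}\mathfrak{p}^{ -ls}\big).$$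
   Context: $\mathcal{N}\mathfrak{p}=q^{\deg\mathfrak{p}}$, where $\mathbb{F}_q$ is the exact constant field of $F$. $r_i(G)=\log_p[p^{i-1}G:p^iG]$; $w_i(m)=\lfloor (m-1)/p^{i-1}\rfloor-\lfloor (m-1)/p^i\rfloor$ for $m\ge1$ and $w_i(0)=0$; $u_G(\mathfrak{p}^m)=\mathcal{N}\mathfrak{p}^{\sum_{i=1}^e r_i(G)w_i(m)}$; $b_G(\mathfrak{p}^0)=1$ and $b_G(\mathfrak{p}^m)=u_G(\mathfrak{p}^m)-u_G(\mathfrak{p}^{m-1})$ for $m\ge1$; $\zeta_{F,\mathfrak{p}}(s)=(1-\mathcal{N}\mathfrak{p}^{ -s})^{ -1}$. -}

module Defs where

open import Data.Nat as ℕ using (ℕ; zero; suc; _∸_; _^_; _≤_; _<?_; _≟_)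
import Data.Nat.DivMod as DM
open import Data.Nat.Divisibility using (_∣?_)
open import Data.Integer as ℤ using (ℤ; +_; _+_; _*_; _-_; -_)
open import Data.List using (List; map)
open import Data.Nat.ListAction using (sum)
open import Relation.Binary.PropositionalEquality using (_≡_)
open import Relation.Nullary using (yes; no)
open import Data.Product using (_×_)

-- natural-number division, with the (unused) convention m div 0 = 0
_div_ : ℕ → ℕ → ℕ
m div zero    = 0
m div (suc d) = m DM./ suc d

Σ₁ : ℕ → (ℕ → ℕ) → ℕ
Σ₁ zero    f = 0
Σ₁ (suc n) f = Σ₁ n f ℕ.+ f (suc n)

Σ₀ℤ : ℕ → (ℕ → ℤ) → ℤ
Σ₀ℤ zero    f = f 0
Σ₀ℤ (suc n) f = Σ₀ℤ n f + f (suc n)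

-- Finite abelian p-groups, given by their cyclic decomposition
-- G ≅ ⊕_j ℤ/p^{a_j}, represented by the list a of exponents.

-- log_p |p^k G|  =  Σ_j max(a_j - k, 0)
logOrd-pPow : List ℕ → ℕ → ℕ
logOrd-pPow a k = sum (map (λ x → x ∸ k) a)

-- r_i(G) = log_p [p^{i-1} G : p^i G] = log_p|p^{i-1}G| - log_p|p^i G|
r : List ℕ → ℕ → ℕ
r a i = logOrd-pPow a (i ∸ 1) ∸ logOrd-pPow a i

HasExponent : List ℕ → ℕ → Set
HasExponent a e = (logOrd-pPow a e ≡ 0) × (∀ k → logOrd-pPow a k ≡ 0 → e ≤ k)

-- The arithmetic functions of the paper (p = characteristic, e exponent,
-- N = 𝒩𝔭)

w : (p i m : ℕ) → ℕ
w p i zero    = 0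
w p i (suc m) = (m div (p ^ (i ∸ 1))) ∸ (m div (p ^ i))

wexp : (p : ℕ) (a : List ℕ) (e m : ℕ) → ℕ
wexp p a e m = Σ₁ e (λ i → r a i ℕ.* w p i m)

u : (p : ℕ) (a : List ℕ) (e N m : ℕ) → ℕ
u p a e N m = N ^ wexp p a e m

b : (p : ℕ) (a : List ℕ) (e N m : ℕ) → ℤ
b p a e N zero    = + 1
b p a e N (suc m) = + u p a e N (suc m) - + u p a e N m

-- Formal Dirichlet series in 𝒩𝔭^{-s}: a series Σ_n c_n 𝒩𝔭^{-ns} is
-- represented by its coefficient sequence n ↦ c_n (i.e. as a formal
-- power series in X = 𝒩𝔭^{-s}).

Series : Set
Series = ℕ → ℤ

one : Series
one zero    = + 1
one (suc n) = + 0

_⊛_ : Series → Series → Series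
(A ⊛ B) n = Σ₀ℤ n (λ k → A k * B (n ∸ k))

∏₁ : ℕ → (ℕ → Series) → Series
∏₁ zero    S = one
∏₁ (suc n) S = ∏₁ n S ⊛ S (suc n)

Φ : (p : ℕ) (a : List ℕ) (e N : ℕ) → Series
Φ p a e N m = b p a e N m

-- ζ_{F,𝔭}(l s - c) = (1 - 𝒩𝔭^{c} 𝒩𝔭^{-ls})^{-1} = Σ_k 𝒩𝔭^{ck} 𝒩𝔭^{-lks}
-- as a series in 𝒩𝔭^{-s}  (for l ≥ 1)
ζshift : (N l c : ℕ) → Series
ζshift N l c n with l ∣? n
... | yes _ = + (N ^ (c ℕ.* (n div l)))
... | no  _ = + 0

Λ : (p : ℕ) (a : List ℕ) (e N : ℕ) → Series
Λ p a e N = ∏₁ (p ^ e ∸ 1) (λ k → ζshift N (suc k) (wexp p a e (suc k)))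

Ψ-first : (p : ℕ) (a : List ℕ) (e N : ℕ) → Series
Ψ-first p a e N zero = + 1
Ψ-first p a e N (suc n) with suc n <? p ^ e
... | yes _ = + u p a e N (suc n)
... | no  _ = + 0

one-minus-uX : (p : ℕ) (a : List ℕ) (e N l : ℕ) → Series
one-minus-uX p a e N l zero = + 1
one-minus-uX p a e N l (suc n) with suc n ≟ l
... | yes _ = - (+ u p a e N l)
... | no  _ = + 0

Ψ : (p : ℕ) (a : List ℕ) (e N : ℕ) → Series
Ψ p a e N = Ψ-first p a e N ⊛ ∏₁ (p ^ e ∸ 1) (one-minus-uX p a e N)

-- Write X = 𝒩𝔭^{-s} and U = Σ_m u_G(𝔭^m) X^m.  Since p^i ∣ p^e for i ≤ e, the floors in w_i
-- split across the period p^e, so w_i(p^e + m) = w_i(p^e) + w_i(m) and hence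
-- u_G(𝔭^{p^e + m}) = u_G(𝔭^{p^e}) u_G(𝔭^m).  In other words (1 - u_G(𝔭^{p^e}) X^{p^e}) U is the
-- truncation 1 + Σ_{l<p^e} u_G(𝔭^l) X^l, while Φ = (1 - X) U because u_G(𝔭) = 1.  Each zeta
-- factor of Λ is (1 - u_G(𝔭^l) X^l)^{-1}, so Λ ∏_{l<p^e} (1 - u_G(𝔭^l) X^l) telescopes to
-- (1 - X) / (1 - u_G(𝔭^{p^e}) X^{p^e}), and Λ Ψ = (1 - X) U = Φ.
module Submission where

open import Defs
open import Data.Nat using (ℕ; _^_; _≤_)
open import Data.Nat.Primality using (Prime; prime⇒nonZero)
open import Data.List using (List)
open import Data.List.Relation.Unary.All using (All)
open import Relation.Binary.PropositionalEquality using (_≡_)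

open import Algebra.Bundles using (CommutativeMonoid)
import Algebra.Properties.CommutativeSemigroup as CommutativeSemigroupProperties
open import Data.Empty using (⊥-elim)
open import Data.Integer using (ℤ; +_; _+_; _*_; _-_; -_)
import Data.Integer.Properties as ℤP
open import Data.Integer.Tactic.RingSolver using (solve-∀)
open import Data.Nat as ℕ using (zero; suc; _∸_; _<_; _<?_; _≟_; s≤s; NonZero)
import Data.Nat.Properties as ℕP
open import Data.Nat.DivMod
  using (_/_; +-distrib-/-∣ˡ; +-distrib-/-∣ʳ; /-monoʳ-≤; n/n≡1; m*n/n≡m; m<n⇒m/n≡0)
open import Data.Nat.Divisibility
  using (_∣_; _∣?_; divides; divides-refl; ∣-refl; ∣-trans; ∣⇒≤; n∣m*n; m∣m*n; ∣m+n∣m⇒∣n; ∣m∣n⇒∣m+n)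
open import Data.Product using (_,_)
open import Level using (0ℓ)
open import Relation.Binary.PropositionalEquality
  using (_≗_; refl; sym; trans; cong; cong₂; subst; module ≡-Reasoning)
import Relation.Binary.Reasoning.Setoid as SetoidReasoning
open import Relation.Nullary using (yes; no; ¬_)

Σ₀ℤ-cong : ∀ n {f g : ℕ → ℤ} → (∀ k → k ≤ n → f k ≡ g k) → Σ₀ℤ n f ≡ Σ₀ℤ n g
Σ₀ℤ-cong zero    f≡g = f≡g 0 ℕ.z≤n
Σ₀ℤ-cong (suc n) f≡g =
  cong₂ _+_ (Σ₀ℤ-cong n (λ k k≤n → f≡g k (ℕP.m≤n⇒m≤1+n k≤n))) (f≡g (suc n) ℕP.≤-refl)

Σ₀ℤ-zero : ∀ n {f : ℕ → ℤ} → (∀ k → f k ≡ + 0) → Σ₀ℤ n f ≡ + 0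
Σ₀ℤ-zero zero    f≡0 = f≡0 0
Σ₀ℤ-zero (suc n) f≡0 = cong₂ _+_ (Σ₀ℤ-zero n f≡0) (f≡0 (suc n))

Σ₀ℤ-+ : ∀ n (f g : ℕ → ℤ) → Σ₀ℤ n (λ k → f k + g k) ≡ Σ₀ℤ n f + Σ₀ℤ n g
Σ₀ℤ-+ zero    f g = refl
Σ₀ℤ-+ (suc n) f g = trans (cong (_+ (f (suc n) + g (suc n))) (Σ₀ℤ-+ n f g))
                          (interchange (Σ₀ℤ n f) (Σ₀ℤ n g) (f (suc n)) (g (suc n)))
  where
  interchange : ∀ a b c d → (a + b) + (c + d) ≡ (a + c) + (b + d)
  interchange = solve-∀

Σ₀ℤ-*ˡ : ∀ n c (f : ℕ → ℤ) → Σ₀ℤ n (λ k → c * f k) ≡ c * Σ₀ℤ n f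
Σ₀ℤ-*ˡ zero    c f = refl
Σ₀ℤ-*ˡ (suc n) c f =
  trans (cong (_+ c * f (suc n)) (Σ₀ℤ-*ˡ n c f)) (sym (ℤP.*-distribˡ-+ c (Σ₀ℤ n f) (f (suc n))))

Σ₀ℤ-head : ∀ n (f : ℕ → ℤ) → Σ₀ℤ (suc n) f ≡ f 0 + Σ₀ℤ n (λ k → f (suc k))
Σ₀ℤ-head zero    f = refl
Σ₀ℤ-head (suc n) f = trans (cong (_+ f (suc (suc n))) (Σ₀ℤ-head n f)) (ℤP.+-assoc (f 0) _ _)

tail : Series → Series
tail A n = A (suc n)

infixl 6 _⊕_
_⊕_ : Series → Series → Series
(A ⊕ B) n = A n + B n

infixr 7 _·_
_·_ : ℤ → Series → Series
(c · A) n = c * A n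

⊛-suc : ∀ A B n → (A ⊛ B) (suc n) ≡ A 0 * B (suc n) + (tail A ⊛ B) n
⊛-suc A B n = Σ₀ℤ-head n (λ k → A k * B (suc n ∸ k))

⊛-sucʳ : ∀ A B n → (A ⊛ B) (suc n) ≡ (A ⊛ tail B) n + A (suc n) * B 0
⊛-sucʳ A B n = cong₂ _+_
  (Σ₀ℤ-cong n (λ k k≤n → cong (λ i → A k * B i) (ℕP.+-∸-assoc 1 k≤n)))
  (cong (λ i → A (suc n) * B i) (ℕP.n∸n≡0 n))

⊛-cong : ∀ {A A′ B B′} → A ≗ A′ → B ≗ B′ → A ⊛ B ≗ A′ ⊛ B′
⊛-cong A≗A′ B≗B′ n = Σ₀ℤ-cong n (λ k _ → cong₂ _*_ (A≗A′ k) (B≗B′ (n ∸ k)))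

⊛-congˡ : ∀ A {B B′} → B ≗ B′ → A ⊛ B ≗ A ⊛ B′
⊛-congˡ A = ⊛-cong {A} (λ _ → refl)

⊛-congʳ : ∀ B {A A′} → A ≗ A′ → A ⊛ B ≗ A′ ⊛ B
⊛-congʳ B A≗A′ = ⊛-cong {B = B} A≗A′ (λ _ → refl)

⊛-distribʳ-⊕ : ∀ A B C → (A ⊕ B) ⊛ C ≗ (A ⊛ C) ⊕ (B ⊛ C)
⊛-distribʳ-⊕ A B C n =
  trans (Σ₀ℤ-cong n (λ k _ → ℤP.*-distribʳ-+ (C (n ∸ k)) (A k) (B k))) (Σ₀ℤ-+ n _ _)

·-⊛ : ∀ c A B → (c · A) ⊛ B ≗ c · (A ⊛ B)
·-⊛ c A B n = trans (Σ₀ℤ-cong n (λ k _ → ℤP.*-assoc c (A k) (B (n ∸ k)))) (Σ₀ℤ-*ˡ n c _)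

⊛-identityˡ : ∀ A → one ⊛ A ≗ A
⊛-identityˡ A zero    = ℤP.*-identityˡ (A 0)
⊛-identityˡ A (suc n) = begin
  (one ⊛ A) (suc n)              ≡⟨ ⊛-suc one A n ⟩
  + 1 * A (suc n) + (tail one ⊛ A) n ≡⟨ cong₂ _+_ (ℤP.*-identityˡ (A (suc n))) (Σ₀ℤ-zero n (λ _ → refl)) ⟩
  A (suc n) + + 0                ≡⟨ ℤP.+-identityʳ (A (suc n)) ⟩
  A (suc n)                      ∎
  where open ≡-Reasoning

⊛-assoc : ∀ A B C → (A ⊛ B) ⊛ C ≗ A ⊛ (B ⊛ C)
⊛-assoc A B C zero    = ℤP.*-assoc (A 0) (B 0) (C 0)
⊛-assoc A B C (suc n) = begin
  ((A ⊛ B) ⊛ C) (suc n)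
    ≡⟨ ⊛-suc (A ⊛ B) C n ⟩
  A 0 * B 0 * C (suc n) + (tail (A ⊛ B) ⊛ C) n
    ≡⟨ cong (_+_ (A 0 * B 0 * C (suc n))) tail-step ⟩
  A 0 * B 0 * C (suc n) + (A 0 * (tail B ⊛ C) n + (tail A ⊛ (B ⊛ C)) n)
    ≡⟨ regroup (A 0) (B 0) (C (suc n)) ((tail B ⊛ C) n) ((tail A ⊛ (B ⊛ C)) n) ⟩
  A 0 * (B 0 * C (suc n) + (tail B ⊛ C) n) + (tail A ⊛ (B ⊛ C)) n
    ≡⟨ cong (λ x → A 0 * x + (tail A ⊛ (B ⊛ C)) n) (⊛-suc B C n) ⟨
  A 0 * (B ⊛ C) (suc n) + (tail A ⊛ (B ⊛ C)) n
    ≡⟨ ⊛-suc A (B ⊛ C) n ⟨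
  (A ⊛ (B ⊛ C)) (suc n)
    ∎
  where
  open ≡-Reasoning
  regroup : ∀ a b c x y → a * b * c + (a * x + y) ≡ a * (b * c + x) + y
  regroup = solve-∀
  tail-step : (tail (A ⊛ B) ⊛ C) n ≡ A 0 * (tail B ⊛ C) n + (tail A ⊛ (B ⊛ C)) n
  tail-step = begin
    (tail (A ⊛ B) ⊛ C) n
      ≡⟨ ⊛-congʳ C (⊛-suc A B) n ⟩
    (((A 0 · tail B) ⊕ (tail A ⊛ B)) ⊛ C) n
      ≡⟨ ⊛-distribʳ-⊕ (A 0 · tail B) (tail A ⊛ B) C n ⟩
    ((A 0 · tail B) ⊛ C) n + ((tail A ⊛ B) ⊛ C) n
      ≡⟨ cong₂ _+_ (·-⊛ (A 0) (tail B) C n) (⊛-assoc (tail A) B C n) ⟩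
    A 0 * (tail B ⊛ C) n + (tail A ⊛ (B ⊛ C)) n
      ∎

⊛-comm : ∀ A B → A ⊛ B ≗ B ⊛ A
⊛-comm A B zero    = ℤP.*-comm (A 0) (B 0)
⊛-comm A B (suc n) = begin
  (A ⊛ B) (suc n)                   ≡⟨ ⊛-suc A B n ⟩
  A 0 * B (suc n) + (tail A ⊛ B) n  ≡⟨ cong₂ _+_ (ℤP.*-comm (A 0) (B (suc n))) (⊛-comm (tail A) B n) ⟩
  B (suc n) * A 0 + (B ⊛ tail A) n  ≡⟨ ℤP.+-comm (B (suc n) * A 0) ((B ⊛ tail A) n) ⟩
  (B ⊛ tail A) n + B (suc n) * A 0  ≡⟨ ⊛-sucʳ B A n ⟨
  (B ⊛ A) (suc n)                   ∎
  where open ≡-Reasoning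

⊛-commutativeMonoid : CommutativeMonoid 0ℓ 0ℓ
⊛-commutativeMonoid = record
  { Carrier = Series
  ; _≈_ = _≗_
  ; _∙_ = _⊛_
  ; ε = one
  ; isCommutativeMonoid = record
    { isMonoid = record
      { isSemigroup = record
        { isMagma = record
          { isEquivalence = record
            { refl = λ _ → refl
            ; sym = λ A≗B n → sym (A≗B n)
            ; trans = λ A≗B B≗C n → trans (A≗B n) (B≗C n)
            }
          ; ∙-cong = ⊛-cong
          }
        ; assoc = ⊛-assoc
        }
      ; identity = ⊛-identityˡ , λ A n → trans (⊛-comm A one n) (⊛-identityˡ A n)
      }
    ; comm = ⊛-comm
    }
  }

open CommutativeMonoid ⊛-commutativeMonoid using (setoid; commutativeSemigroup)
  renaming (sym to ≗-sym; trans to ≗-trans)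
open CommutativeSemigroupProperties commutativeSemigroup using (interchange; x∙yz≈y∙xz; xy∙z≈zx∙y)

∏₁-telescope : ∀ (g f : ℕ → Series) → (∀ k → g k ⊛ f (suc k) ≗ one) →
               ∀ n → ∏₁ n g ⊛ ∏₁ n f ≗ f 1 ⊛ g n
∏₁-telescope g f inverse zero =
  ≗-trans (⊛-identityˡ one) (≗-trans (≗-sym (inverse 0)) (⊛-comm (g 0) (f 1)))
∏₁-telescope g f inverse (suc n) = begin
  (∏₁ n g ⊛ g (suc n)) ⊛ (∏₁ n f ⊛ f (suc n))
    ≈⟨ interchange (∏₁ n g) (g (suc n)) (∏₁ n f) (f (suc n)) ⟩
  (∏₁ n g ⊛ ∏₁ n f) ⊛ (g (suc n) ⊛ f (suc n))
    ≈⟨ ⊛-cong (∏₁-telescope g f inverse n) (⊛-comm (g (suc n)) (f (suc n))) ⟩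
  (f 1 ⊛ g n) ⊛ (f (suc n) ⊛ g (suc n))
    ≈⟨ ⊛-assoc (f 1) (g n) (f (suc n) ⊛ g (suc n)) ⟩
  f 1 ⊛ (g n ⊛ (f (suc n) ⊛ g (suc n)))
    ≈⟨ ⊛-congˡ (f 1) (≗-sym (⊛-assoc (g n) (f (suc n)) (g (suc n)))) ⟩
  f 1 ⊛ ((g n ⊛ f (suc n)) ⊛ g (suc n))
    ≈⟨ ⊛-congˡ (f 1) (⊛-congʳ (g (suc n)) (inverse n)) ⟩
  f 1 ⊛ (one ⊛ g (suc n))
    ≈⟨ ⊛-congˡ (f 1) (⊛-identityˡ (g (suc n))) ⟩
  f 1 ⊛ g (suc n)
    ∎
  where open SetoidReasoning setoid

monomial : ℤ → ℕ → Series
monomial c zero    zero    = c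
monomial c zero    (suc n) = + 0
monomial c (suc l) zero    = + 0
monomial c (suc l) (suc n) = monomial c l n

monomial-diagonal : ∀ c l → monomial c l l ≡ c
monomial-diagonal c zero    = refl
monomial-diagonal c (suc l) = monomial-diagonal c l

monomial-off-diagonal : ∀ c l n → ¬ n ≡ l → monomial c l n ≡ + 0
monomial-off-diagonal c zero    zero    n≢l = ⊥-elim (n≢l refl)
monomial-off-diagonal c zero    (suc n) n≢l = refl
monomial-off-diagonal c (suc l) zero    n≢l = refl
monomial-off-diagonal c (suc l) (suc n) n≢l = monomial-off-diagonal c l n (λ n≡l → n≢l (cong suc n≡l))

monomial-⊛-below : ∀ c l B n → n < l → (monomial c l ⊛ B) n ≡ + 0
monomial-⊛-below c (suc l) B zero    _         = refl
monomial-⊛-below c (suc l) B (suc n) (s≤s n<l) =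
  trans (⊛-suc (monomial c (suc l)) B n) (cong (_+_ (+ 0)) (monomial-⊛-below c l B n n<l))

monomial-⊛-shift : ∀ c l B m → (monomial c l ⊛ B) (l ℕ.+ m) ≡ c * B m
monomial-⊛-shift c zero    B zero    = refl
monomial-⊛-shift c zero    B (suc m) =
  trans (⊛-suc (monomial c 0) B m)
        (trans (cong (_+_ (c * B (suc m))) (Σ₀ℤ-zero m (λ _ → refl))) (ℤP.+-identityʳ _))
monomial-⊛-shift c (suc l) B m =
  trans (⊛-suc (monomial c (suc l)) B (l ℕ.+ m))
        (trans (cong (_+_ (+ 0)) (monomial-⊛-shift c l B m)) (ℤP.+-identityˡ _))

one-minus-cX^ : ℤ → ℕ → Series
one-minus-cX^ c l = one ⊕ monomial (- c) l

one-minus-cX^-⊛ : ∀ c l {B C : Series} →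
                  (∀ n → n < l → B n ≡ C n) → (∀ m → B (l ℕ.+ m) - c * B m ≡ C (l ℕ.+ m)) →
                  one-minus-cX^ c l ⊛ B ≗ C
one-minus-cX^-⊛ c l {B} {C} below beyond n = begin
  (one-minus-cX^ c l ⊛ B) n                 ≡⟨ ⊛-distribʳ-⊕ one (monomial (- c) l) B n ⟩
  (one ⊛ B) n + (monomial (- c) l ⊛ B) n    ≡⟨ cong (_+ (monomial (- c) l ⊛ B) n) (⊛-identityˡ B n) ⟩
  B n + (monomial (- c) l ⊛ B) n            ≡⟨ coefficient n ⟩
  C n                                       ∎
  where
  open ≡-Reasoning
  coefficient : ∀ n → B n + (monomial (- c) l ⊛ B) n ≡ C n
  coefficient n with n <? l
  ... | yes n<l = trans (cong (_+_ (B n)) (monomial-⊛-below (- c) l B n n<l))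
                        (trans (ℤP.+-identityʳ (B n)) (below n n<l))
  ... | no n≮l with ℕP.m≤n⇒∃[o]m+o≡n (ℕP.≮⇒≥ n≮l)
  ...   | m , refl =
    trans (cong (_+_ (B (l ℕ.+ m))) (trans (monomial-⊛-shift (- c) l B m) (sym (ℤP.neg-distribˡ-* c (B m)))))
          (beyond m)

ζshift-zero : ∀ N j c → ζshift N (suc j) c 0 ≡ + 1
ζshift-zero N j c with suc j ∣? 0
... | yes _  = cong (λ k → + (N ^ k)) (ℕP.*-zeroʳ c)
... | no 0∤ = ⊥-elim (0∤ (divides 0 refl))

ζshift-below : ∀ N j c n → suc n < suc j → ζshift N (suc j) c (suc n) ≡ + 0
ζshift-below N j c n n<l with suc j ∣? suc n
... | yes l∣n = ⊥-elim (ℕP.<⇒≱ n<l (∣⇒≤ l∣n))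
... | no _    = refl

ζshift-shift : ∀ N j c m → ζshift N (suc j) c (suc j ℕ.+ m) ≡ + (N ^ c) * ζshift N (suc j) c m
ζshift-shift N j c m with suc j ∣? (suc j ℕ.+ m) | suc j ∣? m
... | yes _   | yes l∣m = begin
  + (N ^ (c ℕ.* ((suc j ℕ.+ m) / suc j)))     ≡⟨ cong (λ k → + (N ^ (c ℕ.* k))) quotient ⟩
  + (N ^ (c ℕ.* suc (m / suc j)))             ≡⟨ cong (λ k → + (N ^ k)) (ℕP.*-suc c (m / suc j)) ⟩
  + (N ^ (c ℕ.+ c ℕ.* (m / suc j)))           ≡⟨ cong +_ (ℕP.^-distribˡ-+-* N c (c ℕ.* (m / suc j))) ⟩
  + (N ^ c ℕ.* N ^ (c ℕ.* (m / suc j)))       ≡⟨ ℤP.pos-* (N ^ c) (N ^ (c ℕ.* (m / suc j))) ⟩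
  + (N ^ c) * + (N ^ (c ℕ.* (m / suc j)))     ∎
  where
  open ≡-Reasoning
  quotient : (suc j ℕ.+ m) / suc j ≡ suc (m / suc j)
  quotient = trans (+-distrib-/-∣ˡ m ∣-refl) (cong (ℕ._+ (m / suc j)) (n/n≡1 (suc j)))
... | yes l∣l+m | no l∤m  = ⊥-elim (l∤m (∣m+n∣m⇒∣n l∣l+m ∣-refl))
... | no l∤l+m  | yes l∣m = ⊥-elim (l∤l+m (∣m∣n⇒∣m+n ∣-refl l∣m))
... | no _      | no _    = sym (ℤP.*-zeroʳ (+ (N ^ c)))

ζshift-inverse : ∀ N j c → ζshift N (suc j) c ⊛ one-minus-cX^ (+ (N ^ c)) (suc j) ≗ one
ζshift-inverse N j c n =
  trans (⊛-comm (ζshift N (suc j) c) (one-minus-cX^ (+ (N ^ c)) (suc j)) n)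
        (one-minus-cX^-⊛ (+ (N ^ c)) (suc j) below beyond n)
  where
  below : ∀ n → n < suc j → ζshift N (suc j) c n ≡ one n
  below zero    _   = ζshift-zero N j c
  below (suc n) n<l = ζshift-below N j c n n<l
  beyond : ∀ m → ζshift N (suc j) c (suc j ℕ.+ m) - + (N ^ c) * ζshift N (suc j) c m ≡ + 0
  beyond m = trans (cong (_- + (N ^ c) * ζshift N (suc j) c m) (ζshift-shift N j c m))
                   (ℤP.+-inverseʳ (+ (N ^ c) * ζshift N (suc j) c m))

div≡/ : ∀ m d .{{_ : NonZero d}} → m div d ≡ m / d
div≡/ m (suc d) = refl

0-div≡0 : ∀ d → 0 div d ≡ 0
0-div≡0 zero    = refl
0-div≡0 (suc d) = refl

suc-/-∣ : ∀ {m} d .{{_ : NonZero d}} → d ∣ suc m → suc m / d ≡ suc (m / d)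
suc-/-∣ (suc d) (divides-refl (suc q)) = begin
  suc q ℕ.* suc d / suc d                  ≡⟨ m*n/n≡m (suc q) (suc d) ⟩
  suc q                                    ≡⟨ cong suc (cong₂ ℕ._+_ (m<n⇒m/n≡0 (ℕP.n<1+n d)) (m*n/n≡m q (suc d))) ⟨
  suc (d / suc d ℕ.+ q ℕ.* suc d / suc d)  ≡⟨ cong suc (+-distrib-/-∣ʳ d (divides q refl)) ⟨
  suc ((d ℕ.+ q ℕ.* suc d) / suc d)        ∎
  where open ≡-Reasoning

^-monoʳ-∣ : ∀ m {i j} → i ≤ j → m ^ i ∣ m ^ j
^-monoʳ-∣ m {i} i≤j with ℕP.m≤n⇒∃[o]m+o≡n i≤j
... | o , refl = subst (m ^ i ∣_) (sym (ℕP.^-distribˡ-+-* m i o)) (m∣m*n (m ^ o))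

[m+n]∸[o+p]≡[m∸o]+[n∸p] : ∀ {m n o p} → o ≤ m → p ≤ n → (m ℕ.+ n) ∸ (o ℕ.+ p) ≡ (m ∸ o) ℕ.+ (n ∸ p)
[m+n]∸[o+p]≡[m∸o]+[n∸p] {m} {n} {o} {p} o≤m p≤n = begin
  (m ℕ.+ n) ∸ (o ℕ.+ p)  ≡⟨ ℕP.∸-+-assoc (m ℕ.+ n) o p ⟨
  (m ℕ.+ n) ∸ o ∸ p      ≡⟨ cong (_∸ p) (ℕP.+-∸-comm n o≤m) ⟩
  ((m ∸ o) ℕ.+ n) ∸ p    ≡⟨ ℕP.+-∸-assoc (m ∸ o) p≤n ⟩
  (m ∸ o) ℕ.+ (n ∸ p)    ∎
  where open ≡-Reasoning

Σ₁-cong : ∀ n {f g : ℕ → ℕ} → (∀ i → suc i ≤ n → f (suc i) ≡ g (suc i)) → Σ₁ n f ≡ Σ₁ n g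
Σ₁-cong zero    f≡g = refl
Σ₁-cong (suc n) f≡g = cong₂ ℕ._+_ (Σ₁-cong n (λ i i<n → f≡g i (ℕP.m≤n⇒m≤1+n i<n))) (f≡g n ℕP.≤-refl)

Σ₁-zero : ∀ n {f : ℕ → ℕ} → (∀ i → f i ≡ 0) → Σ₁ n f ≡ 0
Σ₁-zero zero    f≡0 = refl
Σ₁-zero (suc n) f≡0 = cong₂ ℕ._+_ (Σ₁-zero n f≡0) (f≡0 (suc n))

Σ₁-+ : ∀ n (f g : ℕ → ℕ) → Σ₁ n (λ i → f i ℕ.+ g i) ≡ Σ₁ n f ℕ.+ Σ₁ n g
Σ₁-+ zero    f g = refl
Σ₁-+ (suc n) f g = trans (cong (ℕ._+ (f (suc n) ℕ.+ g (suc n))) (Σ₁-+ n f g))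
                         (+-interchange (Σ₁ n f) (Σ₁ n g) (f (suc n)) (g (suc n)))
  where open CommutativeSemigroupProperties ℕP.+-commutativeSemigroup renaming (interchange to +-interchange)

module _ (p : ℕ) .{{_ : NonZero p}} where

  w-additive : ∀ i Q k → p ^ suc i ∣ suc Q →
               w p (suc i) (suc Q ℕ.+ suc k) ≡ w p (suc i) (suc Q) ℕ.+ w p (suc i) (suc k)
  w-additive i Q k pⁱ⁺¹∣ = begin
    (Q ℕ.+ suc k) div d₁ ∸ (Q ℕ.+ suc k) div d₂
      ≡⟨ cong₂ _∸_ (split-at-multiple (∣-trans (n∣m*n p) pⁱ⁺¹∣)) (split-at-multiple pⁱ⁺¹∣) ⟩
    suc (Q / d₁ ℕ.+ k / d₁) ∸ suc (Q / d₂ ℕ.+ k / d₂)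
      ≡⟨ [m+n]∸[o+p]≡[m∸o]+[n∸p] (/-monoʳ-≤ Q d₁≤d₂) (/-monoʳ-≤ k d₁≤d₂) ⟩
    (Q / d₁ ∸ Q / d₂) ℕ.+ (k / d₁ ∸ k / d₂)
      ≡⟨ cong₂ ℕ._+_ (cong₂ _∸_ (div≡/ Q d₁) (div≡/ Q d₂)) (cong₂ _∸_ (div≡/ k d₁) (div≡/ k d₂)) ⟨
    (Q div d₁ ∸ Q div d₂) ℕ.+ (k div d₁ ∸ k div d₂) ∎
    where
    open ≡-Reasoning
    d₁ = p ^ i
    d₂ = p ^ suc i
    instance
      d₁-nonZero : NonZero d₁
      d₁-nonZero = ℕP.m^n≢0 p i
      d₂-nonZero : NonZero d₂
      d₂-nonZero = ℕP.m^n≢0 p (suc i)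
    d₁≤d₂ : d₁ ≤ d₂
    d₁≤d₂ = ℕP.m≤n*m d₁ p
    split-at-multiple : ∀ {d} .{{_ : NonZero d}} → d ∣ suc Q → (Q ℕ.+ suc k) div d ≡ suc (Q / d ℕ.+ k / d)
    split-at-multiple {d} d∣ = begin
      (Q ℕ.+ suc k) div d       ≡⟨ div≡/ (Q ℕ.+ suc k) d ⟩
      (Q ℕ.+ suc k) / d         ≡⟨ cong (_/ d) (ℕP.+-suc Q k) ⟩
      (suc Q ℕ.+ k) / d         ≡⟨ +-distrib-/-∣ˡ k d∣ ⟩
      suc Q / d ℕ.+ k / d       ≡⟨ cong (ℕ._+ k / d) (suc-/-∣ d d∣) ⟩
      suc (Q / d ℕ.+ k / d)     ∎

  module _ (a : List ℕ) (e : ℕ) where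

    wexp-zero : wexp p a e 0 ≡ 0
    wexp-zero = Σ₁-zero e (λ i → ℕP.*-zeroʳ (r a i))

    wexp-one : wexp p a e 1 ≡ 0
    wexp-one = Σ₁-zero e (λ i →
      trans (cong (r a i ℕ.*_) (cong₂ _∸_ (0-div≡0 (p ^ (i ∸ 1))) (0-div≡0 (p ^ i)))) (ℕP.*-zeroʳ (r a i)))

    wexp-additive : ∀ Q k → p ^ e ∣ suc Q →
                    wexp p a e (suc Q ℕ.+ suc k) ≡ wexp p a e (suc Q) ℕ.+ wexp p a e (suc k)
    wexp-additive Q k pᵉ∣ = trans (Σ₁-cong e termwise) (Σ₁-+ e _ _)
      where
      termwise : ∀ i → suc i ≤ e →
                 r a (suc i) ℕ.* w p (suc i) (suc Q ℕ.+ suc k)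
                   ≡ r a (suc i) ℕ.* w p (suc i) (suc Q) ℕ.+ r a (suc i) ℕ.* w p (suc i) (suc k)
      termwise i i<e = trans (cong (r a (suc i) ℕ.*_) (w-additive i Q k (∣-trans (^-monoʳ-∣ p i<e) pᵉ∣)))
                             (ℕP.*-distribˡ-+ (r a (suc i)) _ _)

    u-multiplicative : ∀ N Q m → p ^ e ∣ suc Q → u p a e N (suc Q ℕ.+ m) ≡ u p a e N (suc Q) ℕ.* u p a e N m
    u-multiplicative N Q zero _ = begin
      N ^ wexp p a e (suc Q ℕ.+ 0)        ≡⟨ cong (λ x → N ^ wexp p a e x) (ℕP.+-identityʳ (suc Q)) ⟩
      u p a e N (suc Q)                   ≡⟨ ℕP.*-identityʳ (u p a e N (suc Q)) ⟨
      u p a e N (suc Q) ℕ.* 1             ≡⟨ cong (λ x → u p a e N (suc Q) ℕ.* N ^ x) wexp-zero ⟨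
      u p a e N (suc Q) ℕ.* u p a e N 0   ∎
      where open ≡-Reasoning
    u-multiplicative N Q (suc k) pᵉ∣ =
      trans (cong (N ^_) (wexp-additive Q k pᵉ∣)) (ℕP.^-distribˡ-+-* N (wexp p a e (suc Q)) (wexp p a e (suc k)))

module Factorisation (p : ℕ) .{{_ : NonZero p}} (a : List ℕ) (e N : ℕ) where

  U : Series
  U m = + u p a e N m

  Q : ℕ
  Q = p ^ e ∸ 1

  suc-Q : suc Q ≡ p ^ e
  suc-Q = ℕP.suc-pred (p ^ e) {{ℕP.m^n≢0 p e}}

  U-zero : U 0 ≡ + 1
  U-zero = cong (λ x → + (N ^ x)) (wexp-zero p a e)

  U-one : U 1 ≡ + 1
  U-one = cong (λ x → + (N ^ x)) (wexp-one p a e)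

  U-periodic : ∀ m → U (suc Q ℕ.+ m) ≡ U (suc Q) * U m
  U-periodic m = trans (cong +_ (u-multiplicative p a e N Q m (subst (p ^ e ∣_) (sym suc-Q) ∣-refl)))
                       (ℤP.pos-* (u p a e N (suc Q)) (u p a e N m))

  Φ-factor : one-minus-cX^ (U 1) 1 ⊛ U ≗ Φ p a e N
  Φ-factor = one-minus-cX^-⊛ (U 1) 1 below beyond
    where
    below : ∀ n → n < 1 → U n ≡ Φ p a e N n
    below zero _ = U-zero
    below (suc n) (s≤s ())
    beyond : ∀ m → U (suc m) - U 1 * U m ≡ U (suc m) - U m
    beyond m = cong (λ c → U (suc m) - c) (trans (cong (_* U m) U-one) (ℤP.*-identityˡ (U m)))

  Ψ-first-below : ∀ n → suc n < p ^ e → Ψ-first p a e N (suc n) ≡ U (suc n)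
  Ψ-first-below n n<pᵉ with suc n <? p ^ e
  ... | yes _    = refl
  ... | no n≮pᵉ = ⊥-elim (n≮pᵉ n<pᵉ)

  Ψ-first-beyond : ∀ n → p ^ e ≤ suc n → Ψ-first p a e N (suc n) ≡ + 0
  Ψ-first-beyond n pᵉ≤n with suc n <? p ^ e
  ... | yes n<pᵉ = ⊥-elim (ℕP.<⇒≱ n<pᵉ pᵉ≤n)
  ... | no _     = refl

  Ψ-first-factor : one-minus-cX^ (U (suc Q)) (suc Q) ⊛ U ≗ Ψ-first p a e N
  Ψ-first-factor = one-minus-cX^-⊛ (U (suc Q)) (suc Q) below beyond
    where
    below : ∀ n → n < suc Q → U n ≡ Ψ-first p a e N n
    below zero    _   = U-zero
    below (suc n) n<l = sym (Ψ-first-below n (subst (suc n <_) suc-Q n<l))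
    beyond : ∀ m → U (suc Q ℕ.+ m) - U (suc Q) * U m ≡ Ψ-first p a e N (suc Q ℕ.+ m)
    beyond m = begin
      U (suc Q ℕ.+ m) - U (suc Q) * U m   ≡⟨ cong (_- U (suc Q) * U m) (U-periodic m) ⟩
      U (suc Q) * U m - U (suc Q) * U m   ≡⟨ ℤP.+-inverseʳ (U (suc Q) * U m) ⟩
      + 0                                 ≡⟨ Ψ-first-beyond (Q ℕ.+ m) pᵉ≤Q+m ⟨
      Ψ-first p a e N (suc Q ℕ.+ m)       ∎
      where
      open ≡-Reasoning
      pᵉ≤Q+m : p ^ e ≤ suc Q ℕ.+ m
      pᵉ≤Q+m = subst (_≤ suc Q ℕ.+ m) suc-Q (ℕP.m≤m+n (suc Q) m)

  one-minus-uX-factor : ∀ j → one-minus-uX p a e N (suc j) ≗ one-minus-cX^ (U (suc j)) (suc j)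
  one-minus-uX-factor j zero    = refl
  one-minus-uX-factor j (suc n) with suc n ≟ suc j
  ... | yes refl = sym (trans (ℤP.+-identityˡ _) (monomial-diagonal (- U (suc j)) j))
  ... | no n≢j   = sym (trans (ℤP.+-identityˡ _)
                              (monomial-off-diagonal (- U (suc j)) j n (λ n≡j → n≢j (cong suc n≡j))))

  ζ-factor : ℕ → Series
  ζ-factor k = ζshift N (suc k) (wexp p a e (suc k))

  ζ-factor-inverse : ∀ k → ζ-factor k ⊛ one-minus-uX p a e N (suc k) ≗ one
  ζ-factor-inverse k =
    ≗-trans (⊛-congˡ (ζ-factor k) (one-minus-uX-factor k)) (ζshift-inverse N k (wexp p a e (suc k)))

  Φ≗Λ⊛Ψ : Φ p a e N ≗ Λ p a e N ⊛ Ψ p a e N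
  Φ≗Λ⊛Ψ = ≗-sym (begin
    ∏₁ Q ζ-factor ⊛ (Ψ₁ ⊛ ∏₁ Q M)  ≈⟨ x∙yz≈y∙xz (∏₁ Q ζ-factor) Ψ₁ (∏₁ Q M) ⟩
    Ψ₁ ⊛ (∏₁ Q ζ-factor ⊛ ∏₁ Q M)  ≈⟨ ⊛-congˡ Ψ₁ (∏₁-telescope ζ-factor M ζ-factor-inverse Q) ⟩
    Ψ₁ ⊛ (M 1 ⊛ Z)                 ≈⟨ x∙yz≈y∙xz Ψ₁ (M 1) Z ⟩
    M 1 ⊛ (Ψ₁ ⊛ Z)                 ≈⟨ ⊛-congˡ (M 1) (⊛-congʳ Z (≗-sym Ψ-first-factor)) ⟩
    M 1 ⊛ ((B ⊛ U) ⊛ Z)            ≈⟨ ⊛-congˡ (M 1) (xy∙z≈zx∙y B U Z) ⟩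
    M 1 ⊛ ((Z ⊛ B) ⊛ U)            ≈⟨ ⊛-congˡ (M 1) (⊛-congʳ U (ζshift-inverse N Q (wexp p a e (suc Q)))) ⟩
    M 1 ⊛ (one ⊛ U)                ≈⟨ ⊛-cong (one-minus-uX-factor 0) (⊛-identityˡ U) ⟩
    one-minus-cX^ (U 1) 1 ⊛ U      ≈⟨ Φ-factor ⟩
    Φ p a e N                      ∎)
    where
    open SetoidReasoning setoid
    Ψ₁ : Series
    Ψ₁ = Ψ-first p a e N
    M : ℕ → Series
    M = one-minus-uX p a e N
    Z : Series
    Z = ζ-factor Q
    B : Series
    B = one-minus-cX^ (U (suc Q)) (suc Q)

proposition6p3 : (p : ℕ) → Prime p → (f : ℕ) → 1 ≤ f → (d : ℕ) → 1 ≤ d →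
    (a : List ℕ) → All (1 ≤_) a → (e : ℕ) → HasExponent a e →
    ∀ n → Φ p a e ((p ^ f) ^ d) n
          ≡ (Λ p a e ((p ^ f) ^ d) ⊛ Ψ p a e ((p ^ f) ^ d)) n
proposition6p3 p p-prime f _ d _ a _ e _ =
  Factorisation.Φ≗Λ⊛Ψ p {{prime⇒nonZero p-prime}} a e ((p ^ f) ^ d)
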